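{- For every graph $G$ with arboricity $b$, diameter $k$, and maximum degree $\Delta$, $$|V(G)|\leq 4k\,(2b)^k\,\Delta^{\lfloor k/2\rfloor}+1.$$
   Context: The arboricity of a graph $G$ is the minimum number of spanning forests whose union is $G$. -}

module Defs where

open import Data.Nat using (ℕ; zero; suc; _+_; _≤_; _<_)
open import Data.Bool using (Bool; true; false; T; if_then_else_)
open import Data.Fin using (Fin)
open import Data.List using (List; []; _∷_; _∷ʳ_; length; map; allFin)
open import Data.Nat.ListAction using (sum)
open import Data.List.Relation.Unary.Linked using (Linked)
open import Data.List.Relation.Unary.Unique.Propositional using (Unique)
open import Data.Product using (Σ; ∃; ∃-syntax; _×_; _,_)
open import Relation.Binary.PropositionalEquality using (_≡_)
open import Relation.Nullary using (¬_)

record Graph (n : ℕ) : Set where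
  field
    adj   : Fin n → Fin n → Bool
    sym   : ∀ u v → adj u v ≡ adj v u
    irref : ∀ v → adj v v ≡ false
open Graph public

Edge : ∀ {n} → Graph n → Fin n → Fin n → Set
Edge G u v = T (adj G u v)

degree : ∀ {n} → Graph n → Fin n → ℕ
degree {n} G v = sum (map (λ w → if adj G v w then 1 else 0) (allFin n))

IsMaxDegree : ∀ {n} → Graph n → ℕ → Set
IsMaxDegree {n} G Δ = (∀ v → degree G v ≤ Δ) × (∃[ v ] degree G v ≡ Δ)

data Walk {n : ℕ} (G : Graph n) : Fin n → Fin n → ℕ → Set where
  here : ∀ {u} → Walk G u u zero
  step : ∀ {u v w ℓ} → Edge G u v → Walk G v w ℓ → Walk G u w (suc ℓ)

DistLe : ∀ {n} → Graph n → Fin n → Fin n → ℕ → Set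
DistLe G u v d = ∃[ ℓ ] (ℓ ≤ d × Walk G u v ℓ)

IsDiameter : ∀ {n} → Graph n → ℕ → Set
IsDiameter {n} G k =
  (∀ u v → DistLe G u v k) ×
  (∃[ u ] ∃[ v ] (∀ ℓ → ℓ < k → ¬ Walk G u v ℓ))

HasCycle : ∀ {n} → Graph n → Set
HasCycle {n} G = ∃[ x ] ∃[ xs ]
  (2 ≤ length xs × Unique (x ∷ xs) × Linked (Edge G) ((x ∷ xs) ∷ʳ x))

IsForest : ∀ {n} → Graph n → Set
IsForest G = ¬ HasCycle G

SubgraphOf : ∀ {n} → Graph n → Graph n → Set
SubgraphOf F G = ∀ u v → Edge F u v → Edge G u v

ForestCover : ∀ {n} → Graph n → ℕ → Set
ForestCover {n} G b = Σ (Fin b → Graph n) λ F →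
  (∀ i → IsForest (F i)) × (∀ i → SubgraphOf (F i) G) ×
  (∀ u v → Edge G u v → ∃[ i ] Edge (F i) u v)

IsArboricity : ∀ {n} → Graph n → ℕ → Set
IsArboricity G b = ForestCover G b × (∀ c → c < b → ¬ ForestCover G c)

-- Each forest can be oriented with all out-degrees at most 1 (a finite forest always has a
-- vertex with at most one neighbour: point it there and recurse), so G gets an orientation in
-- which every edge is an arc and every out-degree is at most b. Along a walk of length ℓ ≤ k from
-- u to v, say f edges are arcs pointing forward and g = ℓ - f point backward. Then v is reached
-- from u by ℓ steps, each along an out-arc or (at most g times) along an arbitrary edge, and u
-- from v likewise with at most f arbitrary steps. One of f, g is at most ⌊k/2⌋, so v lies in the
-- set of such endpoints from u, or u in that from v; these sets have at most
-- (k + 1)(b + 1)^k Δ^⌊k/2⌋ elements. Double counting the covered ordered pairs gives n ≤ 2C + 1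
-- whenever sets of size C cover every pair of distinct vertices in at least one direction.

module Submission where

open import Defs hiding (sym)
open import Data.Nat using (ℕ; zero; suc; _+_; _*_; _^_; _≤_; _<_; z≤n; s≤s)
open import Data.Nat.Properties hiding (_≟_)
open import Data.Nat.DivMod using (_/_; m*n/n≡m; /-monoˡ-≤)
open import Data.Nat.ListAction using (sum)
open import Data.Nat.Solver using (module +-*-Solver)
open import Data.Bool using (true; false; T; if_then_else_)
open import Data.Fin using (Fin; zero; suc)
open import Data.Fin.Properties using (_≟_; any?; injective⇒≤; toℕ<n)
open import Data.List using (List; []; _∷_; _∷ʳ_; _++_; length; lookup; filter; concatMap; map; allFin; upTo)
open import Data.List.Properties using (length-++; filter-notAll; length-tabulate; length-upTo)
open import Data.List.Membership.Propositional using (_∈_; lose)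
open import Data.List.Membership.Propositional.Properties
  using (∈-lookup; ∈-filter⁺; ∈-allFin; ∈-concatMap⁺; ∈-++⁺ˡ; ∈-++⁺ʳ; ∈-upTo⁺; ∈-upTo⁻; ∈-length)
open import Data.List.Relation.Unary.Any as Any using (here; there)
open import Data.List.Relation.Unary.All as All using ([]; _∷_)
import Data.List.Relation.Unary.All.Properties as All
open import Data.List.Relation.Unary.AllPairs using ([]; _∷_)
open import Data.List.Relation.Unary.Linked using (Linked; []; [-]; _∷_)
open import Data.List.Relation.Unary.Unique.Propositional using (Unique)
open import Data.Product using (∃₂; ∃-syntax; _×_; _,_)
open import Data.Sum using (_⊎_; inj₁; inj₂)
open import Function using (_∘_)
open import Relation.Nullary using (Dec; yes; no; does; ¬_; ¬?; contradiction)
open import Relation.Nullary.Decidable using (T?; _×-dec_; decidable-stable)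
open import Relation.Unary using (Decidable)
open import Relation.Binary.PropositionalEquality
open import Algebra.Properties.CommutativeMonoid.Sum +-0-commutativeMonoid
  using (sum-syntax; ∑-distrib-+; ∑-comm; sum-cong-≗)

m+m≤n⇒m≤n/2 : ∀ {m k} → m + m ≤ k → m ≤ k / 2
m+m≤n⇒m≤n/2 {m} {k} 2m≤k = begin
  m          ≡⟨ m*n/n≡m m 2 ⟨
  m * 2 / 2  ≤⟨ /-monoˡ-≤ 2 (≤-trans (≤-reflexive (trans (*-comm m 2) (cong (m +_) (+-identityʳ m)))) 2m≤k) ⟩
  k / 2      ∎
  where open ≤-Reasoning

m+n≤o⇒m≤o/2⊎n≤o/2 : ∀ {f g k} → f + g ≤ k → f ≤ k / 2 ⊎ g ≤ k / 2
m+n≤o⇒m≤o/2⊎n≤o/2 {f} {g} f+g≤k with ≤-total f g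
... | inj₁ f≤g = inj₁ (m+m≤n⇒m≤n/2 (≤-trans (+-monoʳ-≤ f f≤g) f+g≤k))
... | inj₂ g≤f = inj₂ (m+m≤n⇒m≤n/2 (≤-trans (+-monoˡ-≤ g g≤f) f+g≤k))

m*m≤m*n⇒m≤n : ∀ m k → m * m ≤ m * k → m ≤ k
m*m≤m*n⇒m≤n zero    k _   = z≤n
m*m≤m*n⇒m≤n (suc m) k m²≤ = *-cancelˡ-≤ (suc m) m²≤

𝟙 : ∀ {p} {P : Set p} → Dec P → ℕ
𝟙 d = if does d then 1 else 0

𝟙-yes : ∀ {p} {P : Set p} (d : Dec P) → P → 𝟙 d ≡ 1
𝟙-yes (yes _) _ = refl
𝟙-yes (no ¬p) p = contradiction p ¬p

∑-mono-≤ : ∀ n {f g : Fin n → ℕ} → (∀ i → f i ≤ g i) → ∑[ i < n ] f i ≤ ∑[ i < n ] g i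
∑-mono-≤ zero    f≤g = z≤n
∑-mono-≤ (suc n) f≤g = +-mono-≤ (f≤g zero) (∑-mono-≤ n (f≤g ∘ suc))

∑-const : ∀ n c → ∑[ i < n ] c ≡ n * c
∑-const zero    c = refl
∑-const (suc n) c = cong (c +_) (∑-const n c)

∑-𝟙-≡ : ∀ {n} (u : Fin n) → ∑[ v < n ] 𝟙 (v ≟ u) ≡ 1
∑-𝟙-≡ {suc n} zero    = cong suc (trans (∑-const n 0) (*-zeroʳ n))
∑-𝟙-≡ {suc n} (suc u) = ∑-𝟙-≡ u

module _ {n : ℕ} where
  open import Data.List.Membership.DecPropositional (_≟_ {n}) using (_∈?_)

  𝟙-∈-∷ : ∀ (v y : Fin n) ys → 𝟙 (v ∈? y ∷ ys) ≤ 𝟙 (v ≟ y) + 𝟙 (v ∈? ys)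
  𝟙-∈-∷ v y ys with v ≟ y | v ∈? ys
  ... | yes _ | _     = s≤s z≤n
  ... | no _  | yes _ = ≤-refl
  ... | no _  | no _  = z≤n

  ∑-𝟙-∈ : ∀ (xs : List (Fin n)) → ∑[ v < n ] 𝟙 (v ∈? xs) ≤ length xs
  ∑-𝟙-∈ [] = ≤-reflexive (trans (∑-const n 0) (*-zeroʳ n))
  ∑-𝟙-∈ (y ∷ ys) = begin
    ∑[ v < n ] 𝟙 (v ∈? y ∷ ys)                  ≤⟨ ∑-mono-≤ n (λ v → 𝟙-∈-∷ v y ys) ⟩
    ∑[ v < n ] (𝟙 (v ≟ y) + 𝟙 (v ∈? ys))         ≡⟨ ∑-distrib-+ (λ v → 𝟙 (v ≟ y)) (λ v → 𝟙 (v ∈? ys)) ⟩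
    ∑[ v < n ] 𝟙 (v ≟ y) + ∑[ v < n ] 𝟙 (v ∈? ys) ≤⟨ +-mono-≤ (≤-reflexive (∑-𝟙-≡ y)) (∑-𝟙-∈ ys) ⟩
    1 + length ys                                ∎
    where open ≤-Reasoning

  semicomplete-order-bound : ∀ {C} (N : Fin n → List (Fin n)) →
    (∀ u → length (N u) ≤ C) → (∀ u v → u ≢ v → v ∈ N u ⊎ u ∈ N v) →
    n ≤ 2 * C + 1
  semicomplete-order-bound {C} N |N|≤C semicomplete = m*m≤m*n⇒m≤n n (2 * C + 1) (begin
    n * n                                                 ≡⟨ ∑-const n n ⟨
    ∑[ u < n ] n                                          ≤⟨ ∑-mono-≤ n row ⟩
    ∑[ u < n ] (1 + ∑[ v < n ] (a u v + a v u))           ≡⟨ ∑-distrib-+ {n} (λ _ → 1) _ ⟩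
    ∑[ u < n ] 1 + ∑[ u < n ] ∑[ v < n ] (a u v + a v u)  ≡⟨ cong₂ _+_ (trans (∑-const n 1) (*-identityʳ n)) both-directions ⟩
    n + (A + A)                                           ≤⟨ +-monoʳ-≤ n (+-mono-≤ A≤nC A≤nC) ⟩
    n + (n * C + n * C)                                   ≡⟨ solve 2 (λ n C → n :+ (n :* C :+ n :* C) := n :* (con 2 :* C :+ con 1)) refl n C ⟩
    n * (2 * C + 1)                                       ∎)
    where
    open ≤-Reasoning
    open +-*-Solver

    a : Fin n → Fin n → ℕ
    a u v = 𝟙 (v ∈? N u)

    A : ℕ
    A = ∑[ u < n ] ∑[ v < n ] a u v

    A≤nC : A ≤ n * C
    A≤nC = ≤-trans (∑-mono-≤ n (λ u → ≤-trans (∑-𝟙-∈ (N u)) (|N|≤C u))) (≤-reflexive (∑-const n C))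

    both-directions : ∑[ u < n ] ∑[ v < n ] (a u v + a v u) ≡ A + A
    both-directions = begin-equality
      ∑[ u < n ] ∑[ v < n ] (a u v + a v u)                   ≡⟨ sum-cong-≗ (λ u → ∑-distrib-+ (a u) (λ v → a v u)) ⟩
      ∑[ u < n ] (∑[ v < n ] a u v + ∑[ v < n ] a v u)        ≡⟨ ∑-distrib-+ {n} _ _ ⟩
      A + ∑[ u < n ] ∑[ v < n ] a v u                         ≡⟨ cong (A +_) (∑-comm (λ u v → a v u)) ⟩
      A + A                                                   ∎

    some-direction : ∀ u v → 1 ≤ 𝟙 (v ≟ u) + (a u v + a v u)
    some-direction u v with v ≟ u
    ... | yes _ = s≤s z≤n
    ... | no v≢u with semicomplete u v (v≢u ∘ sym)
    ...   | inj₁ v∈Nu = ≤-trans (≤-reflexive (sym (𝟙-yes (v ∈? N u) v∈Nu))) (m≤m+n _ _)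
    ...   | inj₂ u∈Nv = ≤-trans (≤-reflexive (sym (𝟙-yes (u ∈? N v) u∈Nv))) (m≤n+m _ _)

    row : ∀ u → n ≤ 1 + ∑[ v < n ] (a u v + a v u)
    row u = begin
      n                                                       ≡⟨ trans (∑-const n 1) (*-identityʳ n) ⟨
      ∑[ v < n ] 1                                            ≤⟨ ∑-mono-≤ n (some-direction u) ⟩
      ∑[ v < n ] (𝟙 (v ≟ u) + (a u v + a v u))                ≡⟨ ∑-distrib-+ {n} _ _ ⟩
      ∑[ v < n ] 𝟙 (v ≟ u) + ∑[ v < n ] (a u v + a v u)       ≡⟨ cong (_+ ∑[ v < n ] (a u v + a v u)) (∑-𝟙-≡ u) ⟩
      1 + ∑[ v < n ] (a u v + a v u)                          ∎

module _ {a b} {A : Set a} {B : Set b} where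

  ∈-concatMap⁺′ : ∀ (f : A → List B) {x y xs} → x ∈ xs → y ∈ f x → y ∈ concatMap f xs
  ∈-concatMap⁺′ f x∈xs y∈fx = ∈-concatMap⁺ f (lose x∈xs y∈fx)

  length-concatMap-≤ : ∀ (f : A → List B) {d} xs → (∀ {x} → x ∈ xs → length (f x) ≤ d) →
    length (concatMap f xs) ≤ length xs * d
  length-concatMap-≤ f []       _     = z≤n
  length-concatMap-≤ f (x ∷ xs) |f|≤d = begin
    length (f x ++ concatMap f xs)        ≡⟨ length-++ (f x) ⟩
    length (f x) + length (concatMap f xs) ≤⟨ +-mono-≤ (|f|≤d (here refl)) (length-concatMap-≤ f xs (|f|≤d ∘ there)) ⟩
    _                                      ∎
    where open ≤-Reasoning

module _ {a} {A : Set a} where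

  Unique-lookup-injective : ∀ {xs : List A} → Unique xs → ∀ i j → lookup xs i ≡ lookup xs j → i ≡ j
  Unique-lookup-injective (_   ∷ _) zero    zero    _  = refl
  Unique-lookup-injective (x≢ ∷ _) zero    (suc j) eq = contradiction eq (All.lookup x≢ (∈-lookup j))
  Unique-lookup-injective (x≢ ∷ _) (suc i) zero    eq = contradiction (sym eq) (All.lookup x≢ (∈-lookup i))
  Unique-lookup-injective (_   ∷ u) (suc i) (suc j) eq = cong suc (Unique-lookup-injective u i j eq)

  Unique-++⁻ˡ : ∀ xs {ys : List A} → Unique (xs ++ ys) → Unique xs
  Unique-++⁻ˡ []       _         = []
  Unique-++⁻ˡ (x ∷ xs) (x≢ ∷ u) = All.++⁻ˡ xs x≢ ∷ Unique-++⁻ˡ xs u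

  Linked-prefix-closing : ∀ {r} {R : A → A → Set r} {a y z} qs → Linked R (a ∷ qs) → y ∈ qs → R y z →
    ∃₂ λ ps ss → qs ≡ ps ++ ss × 1 ≤ length ps × Linked R ((a ∷ ps) ∷ʳ z)
  Linked-prefix-closing (q ∷ qs) (Raq ∷ _)  (here refl) Rqz = q ∷ [] , qs , refl , s≤s z≤n , Raq ∷ Rqz ∷ [-]
  Linked-prefix-closing (q ∷ qs) (Raq ∷ lk) (there y∈)  Ryz with Linked-prefix-closing qs lk y∈ Ryz
  ... | ps , ss , refl , _ , lk′ = q ∷ ps , ss , refl , s≤s z≤n , Raq ∷ lk′

Unique⇒length≤ : ∀ {n} {xs : List (Fin n)} → Unique xs → length xs ≤ n
Unique⇒length≤ u = injective⇒≤ (Unique-lookup-injective u _ _)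

module _ {n} (G : Graph n) where

  Edge-sym : ∀ {u v} → Edge G u v → Edge G v u
  Edge-sym {u} {v} = subst T (Graph.sym G u v)

  Edge-irrefl : ∀ {v} → ¬ Edge G v v
  Edge-irrefl {v} = subst T (irref G v)

  neighbours : Fin n → List (Fin n)
  neighbours x = filter (T? ∘ adj G x) (allFin n)

  ∈-neighbours : ∀ {x y} → Edge G x y → y ∈ neighbours x
  ∈-neighbours {x} {y} = ∈-filter⁺ (T? ∘ adj G x) (∈-allFin y)

  length-neighbours : ∀ x → length (neighbours x) ≡ degree G x
  length-neighbours x = count (allFin n)
    where
    count : ∀ ys → length (filter (T? ∘ adj G x) ys) ≡ sum (map (λ w → if adj G x w then 1 else 0) ys)
    count []       = refl
    count (y ∷ ys) with adj G x y
    ... | true  = cong suc (count ys)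
    ... | false = count ys

  Walk-edge : ∀ {u v ℓ} → u ≢ v → Walk G u v ℓ → 1 ≤ ℓ × ∃[ w ] Edge G u w
  Walk-edge u≢u here       = contradiction refl u≢u
  Walk-edge _   (step e _) = s≤s z≤n , _ , e

record Orientation {n} (G : Graph n) (d : ℕ) (L : List (Fin n)) : Set where
  field
    out        : Fin n → List (Fin n)
    out-length : ∀ v → length (out v) ≤ d
    covers     : ∀ {u v} → u ∈ L → v ∈ L → Edge G u v → v ∈ out u ⊎ u ∈ out v
open Orientation

module _ {n} (F : Graph n) (acyclic : IsForest F) where

  AtMostOneNeighbourIn : List (Fin n) → Fin n → Set
  AtMostOneNeighbourIn L x = ∃[ p ] ∀ {y} → y ∈ L → Edge F x y → y ≡ p

  path-chordless : ∀ {c p y} rest → Unique (c ∷ p ∷ rest) → Linked (Edge F) (c ∷ p ∷ rest) →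
    y ∈ rest → ¬ Edge F c y
  path-chordless rest u (e ∷ lk) y∈rest ecy with Linked-prefix-closing rest lk y∈rest (Edge-sym F ecy)
  ... | ps , ss , refl , 1≤|ps| , cycle = acyclic (_ , _ ∷ ps , s≤s 1≤|ps| , Unique-++⁻ˡ (_ ∷ _ ∷ ps) u , e ∷ cycle)

  module _ (L : List (Fin n)) where
    open import Data.List.Membership.DecPropositional (_≟_ {n}) using (_∈?_)

    NeighbourOtherThan : Fin n → Fin n → Set
    NeighbourOtherThan c p = ∃[ y ] (y ∈ L × Edge F c y × y ≢ p)

    neighbour-other-than? : ∀ c p → Dec (NeighbourOtherThan c p)
    neighbour-other-than? c p = any? (λ y → (y ∈? L) ×-dec (T? (adj F c y) ×-dec ¬? (y ≟ p)))

    only-neighbour : ∀ {c p} → ¬ NeighbourOtherThan c p → AtMostOneNeighbourIn L c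
    only-neighbour {c} {p} none = p , λ {y} y∈L e → decidable-stable (y ≟ p) (λ y≢p → none (y , y∈L , e , y≢p))

    -- Extend a path inside L, never stepping back to the previous vertex. Acyclicity keeps the
    -- path simple, so within n steps it reaches a vertex with no other neighbour in L.
    extend-path : ∀ fuel c p rest → n < fuel + length (c ∷ p ∷ rest) →
      Unique (c ∷ p ∷ rest) → Linked (Edge F) (c ∷ p ∷ rest) → c ∈ L →
      ∃[ v ] (v ∈ L × AtMostOneNeighbourIn L v)
    extend-path zero c p rest long u _ _ = contradiction (Unique⇒length≤ u) (<⇒≱ long)
    extend-path (suc fuel) c p rest long u lk c∈L with neighbour-other-than? c p
    ... | no none = c , c∈L , only-neighbour none
    ... | yes (y , y∈L , ecy , y≢p) with y ∈? c ∷ p ∷ rest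
    ...   | yes (here refl)            = contradiction ecy (Edge-irrefl F)
    ...   | yes (there (here y≡p))     = contradiction y≡p y≢p
    ...   | yes (there (there y∈rest)) = contradiction ecy (path-chordless rest u lk y∈rest)
    ...   | no y∉path = extend-path fuel y c (p ∷ rest)
              (subst (n <_) (sym (+-suc fuel _)) long) (All.¬Any⇒All¬ _ y∉path ∷ u) (Edge-sym F ecy ∷ lk) y∈L

    ∃-vertex-with-at-most-one-neighbour : ∀ {x} → x ∈ L → ∃[ v ] (v ∈ L × AtMostOneNeighbourIn L v)
    ∃-vertex-with-at-most-one-neighbour {x} x∈L with neighbour-other-than? x x
    ... | no none = x , x∈L , only-neighbour none
    ... | yes (y , y∈L , exy , y≢x) = extend-path n y x []
            (subst (n <_) (+-comm 2 n) (m≤n+m (suc n) 1)) ((y≢x ∷ []) ∷ [] ∷ []) (Edge-sym F exy ∷ [-]) y∈L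

  forest-orientation : ∀ L → Orientation F 1 L
  forest-orientation L = orient (length L) L ≤-refl
    where
    orient : ∀ m L → length L ≤ m → Orientation F 1 L
    orient _       []       _ = record { out = λ _ → [] ; out-length = λ _ → z≤n ; covers = λ () }
    orient (suc m) (x ∷ xs) (s≤s |xs|≤m)
      with v , v∈L , p , only-p ← ∃-vertex-with-at-most-one-neighbour (x ∷ xs) (here refl) =
      record { out = out′ ; out-length = out′-length ; covers = covers′ }
      where
      v? : Decidable (_≢ v)
      v? = ¬? ∘ (_≟ v)

      L′ : List (Fin n)
      L′ = filter v? (x ∷ xs)

      O : Orientation F 1 L′
      O = orient m L′ (≤-pred (≤-trans (filter-notAll v? (x ∷ xs) (Any.map (λ { refl v≢v → v≢v refl }) v∈L)) (s≤s |xs|≤m)))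

      out′ : Fin n → List (Fin n)
      out′ w with w ≟ v
      ... | yes _ = p ∷ []
      ... | no  _ = out O w

      out′-length : ∀ w → length (out′ w) ≤ 1
      out′-length w with w ≟ v
      ... | yes _ = s≤s z≤n
      ... | no  _ = out-length O w

      covers′ : ∀ {u w} → u ∈ x ∷ xs → w ∈ x ∷ xs → Edge F u w → w ∈ out′ u ⊎ u ∈ out′ w
      covers′ {u} {w} u∈ w∈ e with u ≟ v | w ≟ v
      ... | yes refl | _        = inj₁ (here (only-p w∈ e))
      ... | no _     | yes refl = inj₂ (here (only-p u∈ (Edge-sym F e)))
      ... | no u≢v   | no w≢v   = covers O (∈-filter⁺ v? u∈ u≢v) (∈-filter⁺ v? w∈ w≢v) e

forest-cover-orientation : ∀ {n} {G : Graph n} {b} → ForestCover G b → Orientation G b (allFin n)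
forest-cover-orientation {n} {G} {b} (F , acyclic , _ , covered) = record
  { out        = out′
  ; out-length = λ v → ≤-trans (length-concatMap-≤ (λ i → out (O i) v) (allFin b) (λ {i} _ → out-length (O i) v))
                                (≤-reflexive (trans (cong (_* 1) (length-tabulate {n = b} _)) (*-identityʳ b)))
  ; covers     = covers′
  }
  where
  O : ∀ i → Orientation (F i) 1 (allFin n)
  O i = forest-orientation (F i) (acyclic i) (allFin n)

  out′ : Fin n → List (Fin n)
  out′ v = concatMap (λ i → out (O i) v) (allFin b)

  covers′ : ∀ {u v} → u ∈ allFin n → v ∈ allFin n → Edge G u v → v ∈ out′ u ⊎ u ∈ out′ v
  covers′ {u} {v} u∈ v∈ e with i , eᵢ ← covered u v e with covers (O i) u∈ v∈ eᵢ
  ... | inj₁ v∈out = inj₁ (∈-concatMap⁺′ (λ i → out (O i) u) (∈-allFin i) v∈out)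
  ... | inj₂ u∈out = inj₂ (∈-concatMap⁺′ (λ i → out (O i) v) (∈-allFin i) u∈out)

module MixedWalks {n} (G : Graph n) {b} (O : Orientation G b (allFin n)) where

  data MixedWalk : Fin n → Fin n → ℕ → ℕ → Set where
    []   : ∀ {x g} → MixedWalk x x 0 g
    arc  : ∀ {x y z ℓ g} → y ∈ out O x → MixedWalk y z ℓ g → MixedWalk x z (suc ℓ) g
    edge : ∀ {x y z ℓ g} → Edge G x y → MixedWalk y z ℓ g → MixedWalk x z (suc ℓ) (suc g)

  _∷ʳ-arc_ : ∀ {x y z ℓ g} → MixedWalk x y ℓ g → z ∈ out O y → MixedWalk x z (suc ℓ) g
  []         ∷ʳ-arc a = arc a []
  (arc a′ w)  ∷ʳ-arc a = arc a′ (w ∷ʳ-arc a)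
  (edge e w) ∷ʳ-arc a = edge e (w ∷ʳ-arc a)

  _∷ʳ-edge_ : ∀ {x y z ℓ g} → MixedWalk x y ℓ g → Edge G y z → MixedWalk x z (suc ℓ) (suc g)
  []         ∷ʳ-edge e = edge e []
  (arc a w)  ∷ʳ-edge e = arc a (w ∷ʳ-edge e)
  (edge e′ w) ∷ʳ-edge e = edge e′ (w ∷ʳ-edge e)

  MixedWalk-mono : ∀ {x z ℓ g g′} → g ≤ g′ → MixedWalk x z ℓ g → MixedWalk x z ℓ g′
  MixedWalk-mono _         []         = []
  MixedWalk-mono g≤g′      (arc a w)  = arc a (MixedWalk-mono g≤g′ w)
  MixedWalk-mono (s≤s g≤g′) (edge e w) = edge e (MixedWalk-mono g≤g′ w)

  Walk⇒MixedWalks : ∀ {u v ℓ} → Walk G u v ℓ →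
    ∃₂ λ f g → f + g ≡ ℓ × MixedWalk u v ℓ g × MixedWalk v u ℓ f
  Walk⇒MixedWalks here = 0 , 0 , refl , [] , []
  Walk⇒MixedWalks (step {u} {y} e w) with f , g , refl , uv , vu ← Walk⇒MixedWalks w | covers O (∈-allFin u) (∈-allFin y) e
  ... | inj₁ y∈out = suc f , g , refl , arc y∈out uv , vu ∷ʳ-edge Edge-sym G e
  ... | inj₂ u∈out = f , suc g , +-suc f g , edge e uv , vu ∷ʳ-arc u∈out

  reach : Fin n → ℕ → ℕ → List (Fin n)
  reach x zero    _       = x ∷ []
  reach x (suc ℓ) zero    = concatMap (λ y → reach y ℓ zero) (out O x)
  reach x (suc ℓ) (suc g) = concatMap (λ y → reach y ℓ (suc g)) (out O x) ++ concatMap (λ y → reach y ℓ g) (neighbours G x)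

  MixedWalk⇒∈reach : ∀ {x z ℓ g} → MixedWalk x z ℓ g → z ∈ reach x ℓ g
  MixedWalk⇒∈reach []                     = here refl
  MixedWalk⇒∈reach {g = zero}  (arc a w)  = ∈-concatMap⁺′ _ a (MixedWalk⇒∈reach w)
  MixedWalk⇒∈reach {g = suc g} (arc a w)  = ∈-++⁺ˡ (∈-concatMap⁺′ _ a (MixedWalk⇒∈reach w))
  MixedWalk⇒∈reach {x} {ℓ = suc ℓ} {suc g} (edge e w) =
    ∈-++⁺ʳ (concatMap (λ y → reach y ℓ (suc g)) (out O x)) (∈-concatMap⁺′ _ (∈-neighbours G e) (MixedWalk⇒∈reach w))

  within : Fin n → ℕ → ℕ → List (Fin n)
  within x k g = concatMap (λ ℓ → reach x ℓ g) (upTo (suc k))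

  Walk⇒∈within : ∀ {u v ℓ k} → ℓ ≤ k → Walk G u v ℓ → v ∈ within u k (k / 2) ⊎ u ∈ within v k (k / 2)
  Walk⇒∈within {u} {v} {k = k} ℓ≤k w with f , g , refl , uv , vu ← Walk⇒MixedWalks w | m+n≤o⇒m≤o/2⊎n≤o/2 ℓ≤k
  ... | inj₂ g≤h = inj₁ (∈-concatMap⁺′ (λ ℓ → reach u ℓ (k / 2)) (∈-upTo⁺ (s≤s ℓ≤k)) (MixedWalk⇒∈reach (MixedWalk-mono g≤h uv)))
  ... | inj₁ f≤h = inj₂ (∈-concatMap⁺′ (λ ℓ → reach v ℓ (k / 2)) (∈-upTo⁺ (s≤s ℓ≤k)) (MixedWalk⇒∈reach (MixedWalk-mono f≤h vu)))

  module _ {Δ} (degree≤Δ : ∀ v → degree G v ≤ Δ) (1≤Δ : 1 ≤ Δ) where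

    length-reach : ∀ x ℓ g → length (reach x ℓ g) ≤ suc b ^ ℓ * Δ ^ g
    length-reach x zero g = begin
      1           ≡⟨ ^-zeroˡ g ⟨
      1 ^ g       ≤⟨ ^-monoˡ-≤ g 1≤Δ ⟩
      Δ ^ g       ≡⟨ +-identityʳ (Δ ^ g) ⟨
      1 * Δ ^ g   ∎
      where open ≤-Reasoning
    length-reach x (suc ℓ) zero = begin
      length (concatMap (λ y → reach y ℓ zero) (out O x)) ≤⟨ length-concatMap-≤ _ (out O x) (λ {y} _ → length-reach y ℓ zero) ⟩
      length (out O x) * (B * 1)                          ≤⟨ *-monoˡ-≤ (B * 1) (out-length O x) ⟩
      b * (B * 1)                                         ≤⟨ m≤n+m (b * (B * 1)) (B * 1) ⟩
      suc b * (B * 1)                                     ≡⟨ *-assoc (suc b) B 1 ⟨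
      suc b ^ suc ℓ * 1                                   ∎
      where
      open ≤-Reasoning
      B : ℕ
      B = suc b ^ ℓ
    length-reach x (suc ℓ) (suc g) = begin
      length (concatMap (λ y → reach y ℓ (suc g)) (out O x) ++ concatMap (λ y → reach y ℓ g) (neighbours G x))
        ≡⟨ length-++ (concatMap (λ y → reach y ℓ (suc g)) (out O x)) ⟩
      length (concatMap (λ y → reach y ℓ (suc g)) (out O x)) + length (concatMap (λ y → reach y ℓ g) (neighbours G x))
        ≤⟨ +-mono-≤ (length-concatMap-≤ _ (out O x) (λ {y} _ → length-reach y ℓ (suc g)))
                    (length-concatMap-≤ _ (neighbours G x) (λ {y} _ → length-reach y ℓ g)) ⟩
      length (out O x) * (B * (Δ * D)) + length (neighbours G x) * (B * D)
        ≤⟨ +-mono-≤ (*-monoˡ-≤ _ (out-length O x)) (*-monoˡ-≤ _ (≤-trans (≤-reflexive (length-neighbours G x)) (degree≤Δ x))) ⟩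
      b * (B * (Δ * D)) + Δ * (B * D)
        ≡⟨ solve 4 (λ b B Δ D → b :* (B :* (Δ :* D)) :+ Δ :* (B :* D) := ((con 1 :+ b) :* B) :* (Δ :* D)) refl b B Δ D ⟩
      suc b ^ suc ℓ * Δ ^ suc g ∎
      where
      open ≤-Reasoning
      open +-*-Solver
      B D : ℕ
      B = suc b ^ ℓ
      D = Δ ^ g

    length-within : ∀ x k h → length (within x k h) ≤ suc k * (suc b ^ k * Δ ^ h)
    length-within x k h = ≤-trans
      (length-concatMap-≤ (λ ℓ → reach x ℓ h) (upTo (suc k)) (λ {ℓ} ℓ∈ → ≤-trans (length-reach x ℓ h)
        (*-monoˡ-≤ (Δ ^ h) (^-monoʳ-≤ (suc b) (≤-pred (∈-upTo⁻ ℓ∈))))))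
      (≤-reflexive (cong (_* (suc b ^ k * Δ ^ h)) (length-upTo (suc k))))

nontrivial-parameters : ∀ {n} (G : Graph (suc (suc n))) {b k Δ} → ForestCover G b →
  (∀ u v → DistLe G u v k) → (∀ v → degree G v ≤ Δ) → 1 ≤ b × 1 ≤ k × 1 ≤ Δ
nontrivial-parameters G (_ , _ , _ , covered) diameter≤k degree≤Δ
  with ℓ , ℓ≤k , w ← diameter≤k zero (suc zero)
  with 1≤ℓ , x , e ← Walk-edge G (λ ()) w
  with i , _ ← covered zero x e
  = ≤-trans (s≤s z≤n) (toℕ<n i)
  , ≤-trans 1≤ℓ ℓ≤k
  , ≤-trans (∈-length (∈-neighbours G e)) (≤-trans (≤-reflexive (length-neighbours G zero)) (degree≤Δ zero))

2[1+k][1+b]^k≤4k[2b]^k : ∀ {k b} D → 1 ≤ k → 1 ≤ b → 2 * (suc k * (suc b ^ k * D)) ≤ 4 * k * (2 * b) ^ k * D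
2[1+k][1+b]^k≤4k[2b]^k {k} {b} D 1≤k 1≤b = begin
  2 * (suc k * (suc b ^ k * D))    ≡⟨ solve 3 (λ k B D → con 2 :* ((con 1 :+ k) :* (B :* D)) := (con 2 :+ con 2 :* k) :* B :* D) refl k (suc b ^ k) D ⟩
  (2 + 2 * k) * suc b ^ k * D         ≤⟨ *-monoˡ-≤ D (*-mono-≤ (+-monoˡ-≤ (2 * k) (*-monoʳ-≤ 2 1≤k)) (^-monoˡ-≤ k 1+b≤2b)) ⟩
  (2 * k + 2 * k) * (2 * b) ^ k * D   ≡⟨ cong (λ c → c * (2 * b) ^ k * D) (solve 1 (λ k → con 2 :* k :+ con 2 :* k := con 4 :* k) refl k) ⟩
  4 * k * (2 * b) ^ k * D          ∎
  where
  open ≤-Reasoning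
  open +-*-Solver

  1+b≤2b : suc b ≤ 2 * b
  1+b≤2b = ≤-trans (+-monoˡ-≤ b 1≤b) (≤-reflexive (cong (b +_) (sym (+-identityʳ b))))

mainTheorem1 : ∀ (n : ℕ) (G : Graph n) (b k Δ : ℕ) →
    IsArboricity G b → IsDiameter G k → IsMaxDegree G Δ →
    n ≤ 4 * k * (2 * b) ^ k * Δ ^ (k / 2) + 1
mainTheorem1 zero _ _ _ _ _ _ _ = z≤n
mainTheorem1 (suc zero) _ _ _ _ _ _ _ = m≤n+m 1 _
mainTheorem1 n@(suc (suc _)) G b k Δ (cover , _) (diameter≤k , _) (degree≤Δ , _)
  with 1≤b , 1≤k , 1≤Δ ← nontrivial-parameters G cover diameter≤k degree≤Δ = begin
  n                                               ≤⟨ semicomplete-order-bound (λ u → within u k (k / 2))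
                                                       (λ u → length-within degree≤Δ 1≤Δ u k (k / 2)) semicomplete ⟩
  2 * (suc k * (suc b ^ k * Δ ^ (k / 2))) + 1     ≤⟨ +-monoˡ-≤ 1 (2[1+k][1+b]^k≤4k[2b]^k (Δ ^ (k / 2)) 1≤k 1≤b) ⟩
  4 * k * (2 * b) ^ k * Δ ^ (k / 2) + 1           ∎
  where
  open ≤-Reasoning
  open MixedWalks G (forest-cover-orientation cover)

  semicomplete : ∀ u v → u ≢ v → v ∈ within u k (k / 2) ⊎ u ∈ within v k (k / 2)
  semicomplete u v _ with ℓ , ℓ≤k , w ← diameter≤k u v = Walk⇒∈within ℓ≤k w
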